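{- The following data define a 2-category: 0-cells are graphs; 1-cells $G\to H$ are graph morphisms, composed as functions; for graph morphisms $f,f':G\to H$, the 2-cells $f\Rightarrow f'$ are the homotopy classes $[\alpha]$ of homotopies $\alpha$ from $f$ to $f'$; vertical composition is $[\alpha]*[\alpha']=[\alpha*\alpha']$ (concatenation); and horizontal composition of $[\alpha]:f\Rightarrow f'$ (with $f,f':G\to H$) and $[\beta]:g\Rightarrow g'$ (with $g,g':H\to K$) is $[\alpha\circ\beta]$ where $\alpha\circ\beta=g\alpha*\beta f'$. (In particular both compositions are well defined on homotopy classes, associative, unital, and satisfy the interchange law.)
   Context: A graph is a finite undirected graph $G$ with vertex set $V(G)$ and edge set $E(G)$, where loops $v\text{ --- }v$ are allowed and two vertices are joined by at most one edge. A graph morphism $f:G\to H$ is a map $V(G)\to V(H)$ with $v\text{ --- }w\Rightarrow f(v)\text{ --- }f(w)$. The exponential graph $H^G$ has as vertices all set maps $V(G)\to V(H)$, with $f\text{ --- }g$ iff for every edge $v_1\text{ --- }v_2$ of $G$ (loops included) $f(v_1)\text{ --- }g(v_2)$ in $H$. $I_n^{\ell}$ is the looped path graph with vertices $0,\dots,n$ and edges $i\text{ --- }i$ and $i\text{ --- }i+1$. A homotopy of length $n$ from a morphism $f$ to a morphism $g$ ($G\to H$) is a graph morphism $I_n^{\ell}\to H^G$ with $0\mapsto f$, $n\mapsto g$; equivalently a sequence $(f_0,\dots,f_n)$ of graph morphisms $G\to H$ with $f_0=f$, $f_n=g$, $f_i\text{ --- }f_{i+1}$ in $H^G$. Concatenation: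 $(f_0,\dots,f_n)*(h_0,\dots,h_m)=(f_0,\dots,f_n,h_1,\dots,h_m)$ when $f_n=h_0$. Whiskering: $g\alpha=(gf_0,\dots,gf_n)$ and $\alpha e=(f_0e,\dots,f_ne)$ for morphisms $g$ out of $H$ and $e$ into $G$. Two homotopies $\lambda,\lambda'$ of the same length $n$ from $f$ to $f'$ are homotopic (and then lie in the same homotopy class) if there is a sequence $\lambda=\lambda_0,\dots,\lambda_k=\lambda'$ of homotopies of length $n$ from $f$ to $f'$ with $\lambda_j(i)\text{ --- }\lambda_{j+1}(i')$ in $H^G$ whenever $i\text{ --- }i'$ in $I_n^{\ell}$; homotopy classes are the equivalence classes of this relation. -}

module Defs where

open import Data.Nat using (ℕ; zero; suc; _+_; _≤_; _<_; s≤s; z≤n)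
open import Data.Fin using (Fin)
open import Data.Bool using (Bool; T)
open import Data.Product using (Σ; _,_)
open import Data.Sum using (_⊎_)
open import Relation.Binary.PropositionalEquality
  using (_≡_; refl; sym; trans; cong; subst₂)
open import Relation.Binary.Construct.Closure.ReflexiveTransitive using (Star)
open import Relation.Binary.Structures using (IsEquivalence)

-- Finite undirected graphs, loops allowed, at most one edge between two
-- vertices: vertex set Fin size, symmetric Boolean adjacency.

record Graph : Set where
  field
    size    : ℕ
    adj     : Fin size → Fin size → Bool
    adj-sym : ∀ v w → adj v w ≡ adj w v

open Graph public

Vertex : Graph → Set
Vertex G = Fin (size G)

Edge : (G : Graph) → Vertex G → Vertex G → Set
Edge G v w = T (adj G v w)

record Mor (G H : Graph) : Set where
  field
    map  : Vertex G → Vertex H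
    pres : ∀ {v w} → Edge G v w → Edge H (map v) (map w)

open Mor public

idMor : (G : Graph) → Mor G G
idMor G = record { map = λ v → v ; pres = λ e → e }

_∘m_ : ∀ {G H K} → Mor H K → Mor G H → Mor G K
g ∘m f = record { map = λ v → map g (map f v) ; pres = λ e → pres g (pres f e) }

_≈m_ : ∀ {G H} → Mor G H → Mor G H → Set
f ≈m g = ∀ v → map f v ≡ map g v

≈m-sym : ∀ {G H} {f g : Mor G H} → f ≈m g → g ≈m f
≈m-sym p v = sym (p v)

≈m-trans : ∀ {G H} {f g h : Mor G H} → f ≈m g → g ≈m h → f ≈m h
≈m-trans p q v = trans (p v) (q v)

ExpAdj : ∀ {G H} → Mor G H → Mor G H → Set
ExpAdj {G} {H} f g = ∀ v₁ v₂ → Edge G v₁ v₂ → Edge H (map f v₁) (map g v₂)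

ExpAdj-resp : ∀ {G H} {a a' b b' : Mor G H} →
  a ≈m a' → b ≈m b' → ExpAdj a b → ExpAdj a' b'
ExpAdj-resp {H = H} pa pb h v w e =
  subst₂ (λ x y → T (adj H x y)) (pa v) (pb w) (h v w e)

-- Homotopies from f to g: a sequence (f_0,...,f_len) of morphisms,
-- given as a function ℕ → Mor G H of which only the values at
-- 0,...,len are relevant, with f_0 = f, f_len = g, f_i --- f_{i+1}.

record Htpy {G H : Graph} (f g : Mor G H) : Set where
  field
    len   : ℕ
    at    : ℕ → Mor G H
    start : at 0 ≈m f
    end   : at len ≈m g
    step  : ∀ i → i < len → ExpAdj (at i) (at (suc i))

open Htpy public

-- i --- i' in the looped path graph
Near : ℕ → ℕ → Set
Near i i' = i ≡ i' ⊎ (suc i ≡ i' ⊎ i ≡ suc i')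

HStep : ∀ {G H} {f g : Mor G H} → Htpy f g → Htpy f g → Set
HStep α β = Σ (len α ≡ len β) λ _ →
  ∀ i i' → i ≤ len α → i' ≤ len α → Near i i' → ExpAdj (at α i) (at β i')

_≃_ : ∀ {G H} {f g : Mor G H} → Htpy f g → Htpy f g → Set
_≃_ = Star HStep

infix 4 _≃_

idH : ∀ {G H} (f : Mor G H) → Htpy f f
idH f = record
  { len = 0 ; at = λ _ → f ; start = λ _ → refl ; end = λ _ → refl
  ; step = λ i () }

-- concatenation of sequences: first la entries of a, then b
cat : ∀ {A : Set} → ℕ → (ℕ → A) → (ℕ → A) → ℕ → A
cat zero    a b i       = b i
cat (suc l) a b zero    = a zero
cat (suc l) a b (suc i) = cat l (λ k → a (suc k)) b i

private
  cat-0 : ∀ {G H} l (a b : ℕ → Mor G H) → a l ≈m b 0 → cat l a b 0 ≈m a 0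
  cat-0 zero    a b p = λ v → sym (p v)
  cat-0 (suc l) a b p = λ _ → refl

  cat-end : ∀ {A : Set} l (a b : ℕ → A) j → cat l a b (l + j) ≡ b j
  cat-end zero    a b j = refl
  cat-end (suc l) a b j = cat-end l (λ k → a (suc k)) b j

  cat-step : ∀ {G H} la lb (a b : ℕ → Mor G H) →
    (∀ i → i < la → ExpAdj (a i) (a (suc i))) → a la ≈m b 0 →
    (∀ j → j < lb → ExpAdj (b j) (b (suc j))) →
    ∀ i → i < la + lb → ExpAdj (cat la a b i) (cat la a b (suc i))
  cat-step zero lb a b sa p sb i lt = sb i lt
  cat-step {G} {H} (suc l) lb a b sa p sb zero lt =
    ExpAdj-resp {G} {H} {a 0} {a 0} {a 1} {cat l (λ k → a (suc k)) b 0} (λ _ → refl)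
      (λ v → sym (cat-0 l (λ k → a (suc k)) b p v)) (sa 0 (s≤s z≤n))
  cat-step (suc l) lb a b sa p sb (suc i) (s≤s lt) =
    cat-step l lb (λ k → a (suc k)) b (λ i q → sa (suc i) (s≤s q)) p sb i lt

_*_ : ∀ {G H} {f g h : Mor G H} → Htpy f g → Htpy g h → Htpy f h
α * β = record
  { len   = len α + len β
  ; at    = cat (len α) (at α) (at β)
  ; start = λ v → trans (cat-0 (len α) (at α) (at β)
                        (λ w → trans (end α w) (sym (start β w))) v) (start α v)
  ; end   = λ v → trans (cong (λ m → map m v) (cat-end (len α) (at α) (at β) (len β)))
                        (end β v)
  ; step  = cat-step (len α) (len β) (at α) (at β) (step α)
              (λ w → trans (end α w) (sym (start β w))) (step β)
  }

infixl 6 _*_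

lwhisk : ∀ {G H K} (g : Mor H K) {f f' : Mor G H} → Htpy f f' → Htpy (g ∘m f) (g ∘m f')
lwhisk g α = record
  { len = len α ; at = λ i → g ∘m at α i
  ; start = λ v → cong (map g) (start α v)
  ; end = λ v → cong (map g) (end α v)
  ; step = λ i p v w e → pres g (step α i p v w e) }

rwhisk : ∀ {G H K} {g g' : Mor H K} → Htpy g g' → (e : Mor G H) → Htpy (g ∘m e) (g' ∘m e)
rwhisk α e = record
  { len = len α ; at = λ i → at α i ∘m e
  ; start = λ v → start α (map e v)
  ; end = λ v → end α (map e v)
  ; step = λ i p v w ed → step α i p (map e v) (map e w) (pres e ed) }

_⊚_ : ∀ {G H K} {f f' : Mor G H} {g g' : Mor H K} →
  Htpy f f' → Htpy g g' → Htpy (g ∘m f) (g' ∘m f')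
_⊚_ {f' = f'} {g = g} α β = lwhisk g α * rwhisk β f'

infixl 7 _⊚_

-- The 2-category laws (on homotopy classes, i.e. up to _≃_).
-- 1-cells compose strictly as functions (associativity and units of _∘m_
-- hold definitionally).

record IsTwoCategory : Set₁ where
  field
    ≃-isEquivalence : ∀ {G H} {f g : Mor G H} → IsEquivalence (_≃_ {f = f} {g = g})
    *-cong : ∀ {G H} {f g h : Mor G H} {α α' : Htpy f g} {β β' : Htpy g h} →
      α ≃ α' → β ≃ β' → α * β ≃ α' * β'
    ⊚-cong : ∀ {G H K} {f f' : Mor G H} {g g' : Mor H K}
      {α α' : Htpy f f'} {β β' : Htpy g g'} →
      α ≃ α' → β ≃ β' → α ⊚ β ≃ α' ⊚ β'
    *-assoc : ∀ {G H} {f g h k : Mor G H}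
      (α : Htpy f g) (β : Htpy g h) (γ : Htpy h k) →
      (α * β) * γ ≃ α * (β * γ)
    *-identityˡ : ∀ {G H} {f g : Mor G H} (α : Htpy f g) → idH f * α ≃ α
    *-identityʳ : ∀ {G H} {f g : Mor G H} (α : Htpy f g) → α * idH g ≃ α
    ⊚-assoc : ∀ {G H K L} {f f' : Mor G H} {g g' : Mor H K} {h h' : Mor K L}
      (α : Htpy f f') (β : Htpy g g') (γ : Htpy h h') →
      (α ⊚ β) ⊚ γ ≃ α ⊚ (β ⊚ γ)
    ⊚-identityˡ : ∀ {G H} {f f' : Mor G H} (α : Htpy f f') →
      idH (idMor G) ⊚ α ≃ α
    ⊚-identityʳ : ∀ {G H} {f f' : Mor G H} (α : Htpy f f') →
      α ⊚ idH (idMor H) ≃ α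
    ⊚-idH : ∀ {G H K} (f : Mor G H) (g : Mor H K) →
      idH f ⊚ idH g ≃ idH (g ∘m f)
    interchange : ∀ {G H K} {f f' f'' : Mor G H} {g g' g'' : Mor H K}
      (α : Htpy f f') (α' : Htpy f' f'') (β : Htpy g g') (β' : Htpy g' g'') →
      (α * α') ⊚ (β * β') ≃ (α ⊚ β) * (α' ⊚ β')

module Submission where

-- A homotopy is a walk in the exponential graph H^G; homotopic homotopies are
-- joined by steps in which near indices carry adjacent morphisms.
--   * Near indices of one homotopy carry adjacent morphisms.  Hence steps are
--     symmetric, homotopy is an equivalence relation, and pointwise equal
--     homotopies are homotopic.
--   * Concatenation preserves steps in each argument and is pointwise
--     associative and unital; whiskering preserves steps and distributes over
--     concatenation.  This gives every law except interchange.
--   * Exchange: gα * βf' ≃ βf * g'α.  Both sides trace the grid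
--     (i , j) ↦ β(j) ∘ α(i) along a monotone lattice path from (0,0) to
--     (len α , len β) (east-then-north, resp. north-then-east).  Flipping one
--     corner of a path is a single step, and bubble sort connects the paths.
--   * Interchange follows from exchange by reassociating.

open import Defs
open import Data.Nat using (ℕ; zero; suc; _+_; _∸_; _⊓_; _≤_; _<_; s≤s; z≤n)
open import Data.Nat.Properties
  using (≤-refl; <⇒≤; ≰⇒>; ≮⇒≥; _≤?_; _<?_; m<n⇒m<1+n; m≤n⇒m<n∨m≡n;
         m⊓n≤n; m≤n⇒m⊓n≡m; m+[n∸m]≡n; m≤n+o⇒m∸n≤o; n∸n≡0;
         +-assoc; +-identityʳ)
open import Data.Bool using (T)
open import Data.List using (List; []; _∷_; _++_; length; replicate)
open import Data.Product using (_,_; _×_; proj₁; proj₂)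
open import Data.Sum using (_⊎_; inj₁; inj₂)
open import Relation.Nullary using (yes; no)
open import Relation.Binary.Bundles using (Setoid)
open import Relation.Binary.Structures using (IsEquivalence)
open import Relation.Binary.PropositionalEquality
  using (_≡_; refl; sym; trans; cong; cong₂; subst; module ≡-Reasoning)
open import Relation.Binary.Construct.Closure.ReflexiveTransitive
  using (Star; ε; _◅_; _◅◅_; gmap; reverse)
import Relation.Binary.Reasoning.Setoid as SetoidReasoning

private
  variable
    G H K L : Graph

Near-refl : ∀ {i} → Near i i
Near-refl = inj₁ refl

Near-sym : ∀ {i i'} → Near i i' → Near i' i
Near-sym (inj₁ refl)        = inj₁ refl
Near-sym (inj₂ (inj₁ refl)) = inj₂ (inj₂ refl)
Near-sym (inj₂ (inj₂ refl)) = inj₂ (inj₁ refl)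

Near-suc : ∀ {i i'} → Near i i' → Near (suc i) (suc i')
Near-suc (inj₁ refl)        = inj₁ refl
Near-suc (inj₂ (inj₁ refl)) = inj₂ (inj₁ refl)
Near-suc (inj₂ (inj₂ refl)) = inj₂ (inj₂ refl)

Near-pred : ∀ {i i'} → Near (suc i) (suc i') → Near i i'
Near-pred (inj₁ refl)        = inj₁ refl
Near-pred (inj₂ (inj₁ refl)) = inj₂ (inj₁ refl)
Near-pred (inj₂ (inj₂ refl)) = inj₂ (inj₂ refl)

Near-bound : ∀ {l i i'} → Near i i' → l < i → l ≤ i'
Near-bound (inj₁ refl)        l<i       = <⇒≤ l<i
Near-bound (inj₂ (inj₁ refl)) l<i       = <⇒≤ (m<n⇒m<1+n l<i)
Near-bound (inj₂ (inj₂ refl)) (s≤s l≤i) = l≤i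

Near-split : ∀ l {i i'} → Near i i' → (i ≤ l × i' ≤ l) ⊎ (l ≤ i × l ≤ i')
Near-split l {i} {i'} n with i ≤? l | i' ≤? l
... | yes i≤l | yes i'≤l = inj₁ (i≤l , i'≤l)
... | no  i≰l | _        = inj₂ (<⇒≤ (≰⇒> i≰l) , Near-bound n (≰⇒> i≰l))
... | yes _   | no  i'≰l = inj₂ (Near-bound (Near-sym n) (≰⇒> i'≰l) , <⇒≤ (≰⇒> i'≰l))

Near-∸ : ∀ l {i i'} → Near i i' → l ≤ i → l ≤ i' → Near (i ∸ l) (i' ∸ l)
Near-∸ zero    n _         _          = n
Near-∸ (suc l) n (s≤s l≤i) (s≤s l≤i') = Near-∸ l (Near-pred n) l≤i l≤i'

Near-⊓ : ∀ n {i i'} → Near i i' → Near (i ⊓ n) (i' ⊓ n)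
Near-⊓ n (inj₁ refl)               = inj₁ refl
Near-⊓ n {i} (inj₂ (inj₁ refl))    = ⊓-step i n
  where
  ⊓-step : ∀ i n → Near (i ⊓ n) (suc i ⊓ n)
  ⊓-step zero    zero    = inj₁ refl
  ⊓-step zero    (suc n) = inj₂ (inj₁ refl)
  ⊓-step (suc i) zero    = inj₁ refl
  ⊓-step (suc i) (suc n) = Near-suc (⊓-step i n)
Near-⊓ n {_} {i'} (inj₂ (inj₂ refl)) = Near-sym (Near-⊓ n {i'} (inj₂ (inj₁ refl)))

≡⇒≈m : {f g : Mor G H} → f ≡ g → f ≈m g
≡⇒≈m f≡g v = cong (λ m → map m v) f≡g

ExpAdj-refl : (f : Mor G H) → ExpAdj f f
ExpAdj-refl f _ _ e = pres f e

ExpAdj-sym : {f g : Mor G H} → ExpAdj f g → ExpAdj g f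
ExpAdj-sym {G} {H} {f} {g} f~g v₁ v₂ e =
  subst T (adj-sym H (map f v₂) (map g v₁)) (f~g v₂ v₁ (subst T (adj-sym G v₁ v₂) e))

ExpAdj-∘ : {f f' : Mor G H} {g g' : Mor H K} →
  ExpAdj f f' → ExpAdj g g' → ExpAdj (g ∘m f) (g' ∘m f')
ExpAdj-∘ {f = f} {f'} f~f' g~g' v₁ v₂ e = g~g' (map f v₁) (map f' v₂) (f~f' v₁ v₂ e)

Linked : ℕ → (ℕ → Mor G H) → (ℕ → Mor G H) → Set
Linked n s t = ∀ i i' → i ≤ n → i' ≤ n → Near i i' → ExpAdj (s i) (t i')

Htpy-linked : {f g : Mor G H} (α : Htpy f g) → Linked (len α) (at α) (at α)
Htpy-linked α i .i       _   _   (inj₁ refl)        = ExpAdj-refl (at α i)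
Htpy-linked α i .(suc i) _   i<n (inj₂ (inj₁ refl)) = step α i i<n
Htpy-linked α .(suc i) i i<n _   (inj₂ (inj₂ refl)) =
  ExpAdj-sym {f = at α i} {at α (suc i)} (step α i i<n)

walk : {f g : Mor G H} → Htpy f g → ℕ → Mor G H
walk α i = at α (i ⊓ len α)

walk-adj : {f g : Mor G H} (α : Htpy f g) {i i' : ℕ} →
  Near i i' → ExpAdj (walk α i) (walk α i')
walk-adj α {i} {i'} n =
  Htpy-linked α _ _ (m⊓n≤n i (len α)) (m⊓n≤n i' (len α)) (Near-⊓ (len α) n)

walk-≤ : {f g : Mor G H} (α : Htpy f g) {i : ℕ} → i ≤ len α → walk α i ≡ at α i
walk-≤ α i≤n = cong (at α) (m≤n⇒m⊓n≡m i≤n)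

HStep-sym : {f g : Mor G H} {α β : Htpy f g} → HStep α β → HStep β α
HStep-sym {α = α} {β} (len≡ , linked) = sym len≡ , λ i i' i≤ i'≤ n →
  ExpAdj-sym {f = at α i'} {at β i}
    (linked i' i (subst (i' ≤_) (sym len≡) i'≤) (subst (i ≤_) (sym len≡) i≤) (Near-sym n))

≃-refl : {f g : Mor G H} {α : Htpy f g} → α ≃ α
≃-refl = ε

≃-sym : {f g : Mor G H} {α β : Htpy f g} → α ≃ β → β ≃ α
≃-sym = reverse (λ {α} {β} → HStep-sym {α = α} {β})

≃-isEquivalence : {f g : Mor G H} → IsEquivalence (_≃_ {f = f} {g = g})
≃-isEquivalence = record { refl = ≃-refl ; sym = ≃-sym ; trans = _◅◅_ }

≃-setoid : (f g : Mor G H) → Setoid _ _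
≃-setoid f g = record { Carrier = Htpy f g ; _≈_ = _≃_ ; isEquivalence = ≃-isEquivalence }

module ≃-Reasoning {G H : Graph} {f g : Mor G H} = SetoidReasoning (≃-setoid f g)

pointwise-≃ : {f g : Mor G H} (α β : Htpy f g) → len α ≡ len β →
  (∀ i → i ≤ len α → at α i ≈m at β i) → α ≃ β
pointwise-≃ α β len≡ α≈β = (len≡ , λ i i' i≤ i'≤ n →
  ExpAdj-resp {a = at α i} {at α i} {at α i'} {at β i'}
    (λ _ → refl) (α≈β i' i'≤) (Htpy-linked α i i' i≤ i'≤ n)) ◅ ε

cat-< : ∀ {A : Set} l (a b : ℕ → A) {i} → i < l → cat l a b i ≡ a i
cat-< (suc l) a b {zero}  _         = refl
cat-< (suc l) a b {suc i} (s≤s i<l) = cat-< l (λ k → a (suc k)) b i<l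

cat-+ : ∀ {A : Set} l (a b : ℕ → A) j → cat l a b (l + j) ≡ b j
cat-+ zero    a b j = refl
cat-+ (suc l) a b j = cat-+ l (λ k → a (suc k)) b j

cat-≥ : ∀ {A : Set} l (a b : ℕ → A) {i} → l ≤ i → cat l a b i ≡ b (i ∸ l)
cat-≥ l a b {i} l≤i = trans (cong (cat l a b) (sym (m+[n∸m]≡n l≤i))) (cat-+ l a b (i ∸ l))

cat-≤ : ∀ l (a b : ℕ → Mor G H) → a l ≈m b 0 → ∀ {i} → i ≤ l → cat l a b i ≈m a i
cat-≤ l a b meet {i} i≤l with m≤n⇒m<n∨m≡n i≤l
... | inj₁ i<l  = ≡⇒≈m (cat-< l a b i<l)
... | inj₂ refl = λ v →
  trans (cong (λ k → map k v) (trans (cat-≥ l a b ≤-refl) (cong b (n∸n≡0 l)))) (sym (meet v))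

cat-map : ∀ {A B : Set} (h : A → B) l (a b : ℕ → A) i →
  h (cat l a b i) ≡ cat l (λ k → h (a k)) (λ k → h (b k)) i
cat-map h zero    a b i       = refl
cat-map h (suc l) a b zero    = refl
cat-map h (suc l) a b (suc i) = cat-map h l (λ k → a (suc k)) b i

cat-assoc : ∀ {A : Set} l₁ l₂ (a b c : ℕ → A) i →
  cat (l₁ + l₂) (cat l₁ a b) c i ≡ cat l₁ a (cat l₂ b c) i
cat-assoc zero     l₂ a b c i       = refl
cat-assoc (suc l₁) l₂ a b c zero    = refl
cat-assoc (suc l₁) l₂ a b c (suc i) = cat-assoc l₁ l₂ (λ k → a (suc k)) b c i

cat-split : ∀ l₁ l₂ (a b s : ℕ → Mor G H) →
  (∀ i → i < l₁ → a i ≈m s i) → (∀ j → j ≤ l₂ → b j ≈m s (l₁ + j)) →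
  ∀ k → k ≤ l₁ + l₂ → cat l₁ a b k ≈m s k
cat-split l₁ l₂ a b s lo hi k k≤ with k <? l₁
... | yes k<l₁ = λ v → trans (cong (λ m → map m v) (cat-< l₁ a b k<l₁)) (lo k k<l₁ v)
... | no  k≮l₁ = λ v → trans (cong (λ m → map m v) (cat-≥ l₁ a b l₁≤k))
                             (trans (hi (k ∸ l₁) (m≤n+o⇒m∸n≤o k l₁ k≤) v)
                                    (cong (λ i → map (s i) v) (m+[n∸m]≡n l₁≤k)))
  where l₁≤k = ≮⇒≥ k≮l₁

-- Concatenation of linked pieces is linked.  The cut points are lengths of
-- homotopic homotopies, so they are only propositionally equal.
cat-linked : ∀ {la la'} → la ≡ la' → ∀ lb {a a' b b' : ℕ → Mor G H} →
  Linked la a a' → Linked lb b b' → a la ≈m b 0 → a' la' ≈m b' 0 →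
  Linked (la + lb) (cat la a b) (cat la' a' b')
cat-linked {la = la} refl lb {a} {a'} {b} {b'} aa' bb' meet meet' i i' i≤ i'≤ n
  with Near-split la n
... | inj₁ (i≤la , i'≤la) =
  ExpAdj-resp {a = a i} {cat la a b i} {a' i'} {cat la a' b' i'}
    (λ v → sym (cat-≤ la a b meet i≤la v)) (λ v → sym (cat-≤ la a' b' meet' i'≤la v))
    (aa' i i' i≤la i'≤la n)
... | inj₂ (la≤i , la≤i') =
  ExpAdj-resp {a = b (i ∸ la)} {cat la a b i} {b' (i' ∸ la)} {cat la a' b' i'}
    (≡⇒≈m (sym (cat-≥ la a b la≤i))) (≡⇒≈m (sym (cat-≥ la a' b' la≤i')))
    (bb' (i ∸ la) (i' ∸ la) (m≤n+o⇒m∸n≤o i la i≤) (m≤n+o⇒m∸n≤o i' la i'≤)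
         (Near-∸ la n la≤i la≤i'))

junction : {f g h : Mor G H} (α : Htpy f g) (β : Htpy g h) → at α (len α) ≈m at β 0
junction α β v = trans (end α v) (sym (start β v))

*-stepˡ : {f g h : Mor G H} {α α' : Htpy f g} (β : Htpy g h) →
  HStep α α' → HStep (α * β) (α' * β)
*-stepˡ {α = α} {α'} β (len≡ , linked) = cong (_+ len β) len≡ ,
  cat-linked len≡ (len β) {at α} {at α'} {at β} {at β}
    linked (Htpy-linked β) (junction α β) (junction α' β)

*-stepʳ : {f g h : Mor G H} (α : Htpy f g) {β β' : Htpy g h} →
  HStep β β' → HStep (α * β) (α * β')
*-stepʳ α {β} {β'} (len≡ , linked) = cong (len α +_) len≡ ,
  cat-linked refl (len β) {at α} {at α} {at β} {at β'}
    (Htpy-linked α) linked (junction α β) (junction α β')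

*-cong : {f g h : Mor G H} {α α' : Htpy f g} {β β' : Htpy g h} →
  α ≃ α' → β ≃ β' → α * β ≃ α' * β'
*-cong {α' = α'} {β = β} α≃α' β≃β' =
  gmap (_* β) (λ {x} {y} → *-stepˡ {α = x} {y} β) α≃α'
  ◅◅ gmap (α' *_) (λ {x} {y} → *-stepʳ α' {x} {y}) β≃β'

*-assoc : {f g h k : Mor G H} (α : Htpy f g) (β : Htpy g h) (γ : Htpy h k) →
  (α * β) * γ ≃ α * (β * γ)
*-assoc α β γ = pointwise-≃ _ _ (+-assoc (len α) (len β) (len γ))
  (λ i _ → ≡⇒≈m (cat-assoc (len α) (len β) (at α) (at β) (at γ) i))

*-identityˡ : {f g : Mor G H} (α : Htpy f g) → idH f * α ≃ α
*-identityˡ α = pointwise-≃ _ α refl (λ _ _ _ → refl)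

*-identityʳ : {f g : Mor G H} (α : Htpy f g) → α * idH g ≃ α
*-identityʳ {g = g} α = pointwise-≃ _ α (+-identityʳ (len α)) λ i i≤ →
  cat-≤ (len α) (at α) (λ _ → g) (end α) (subst (i ≤_) (+-identityʳ (len α)) i≤)

lwhisk-cong : (g : Mor H K) {f f' : Mor G H} {α α' : Htpy f f'} →
  α ≃ α' → lwhisk g α ≃ lwhisk g α'
lwhisk-cong g = gmap (lwhisk g) λ (len≡ , linked) →
  len≡ , λ i i' i≤ i'≤ n v w e → pres g (linked i i' i≤ i'≤ n v w e)

rwhisk-cong : {g g' : Mor H K} {β β' : Htpy g g'} (e : Mor G H) →
  β ≃ β' → rwhisk β e ≃ rwhisk β' e
rwhisk-cong e = gmap (λ β → rwhisk β e) λ (len≡ , linked) →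
  len≡ , λ i i' i≤ i'≤ n v w ed → linked i i' i≤ i'≤ n (map e v) (map e w) (pres e ed)

lwhisk-* : (g : Mor H K) {f f' f'' : Mor G H} (α : Htpy f f') (α' : Htpy f' f'') →
  lwhisk g (α * α') ≃ lwhisk g α * lwhisk g α'
lwhisk-* g α α' = pointwise-≃ _ _ refl
  (λ i _ → ≡⇒≈m (cat-map (g ∘m_) (len α) (at α) (at α') i))

rwhisk-* : {g g' g'' : Mor H K} (β : Htpy g g') (β' : Htpy g' g'') (e : Mor G H) →
  rwhisk (β * β') e ≃ rwhisk β e * rwhisk β' e
rwhisk-* β β' e = pointwise-≃ _ _ refl
  (λ i _ → ≡⇒≈m (cat-map (_∘m e) (len β) (at β) (at β') i))

⊚-cong : {f f' : Mor G H} {g g' : Mor H K} {α α' : Htpy f f'} {β β' : Htpy g g'} →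
  α ≃ α' → β ≃ β' → α ⊚ β ≃ α' ⊚ β'
⊚-cong {f' = f'} {g = g} α≃α' β≃β' = *-cong (lwhisk-cong g α≃α') (rwhisk-cong f' β≃β')

-- Whiskering by a composite is iterated whiskering, pointwise on the nose.
⊚-assoc : {f f' : Mor G H} {g g' : Mor H K} {h h' : Mor K L}
  (α : Htpy f f') (β : Htpy g g') (γ : Htpy h h') → (α ⊚ β) ⊚ γ ≃ α ⊚ (β ⊚ γ)
⊚-assoc {f' = f'} {g = g} {g'} {h = h} α β γ = begin
  lwhisk h (lwhisk g α * rwhisk β f') * rwhisk γ (g' ∘m f')
    ≈⟨ *-cong {β = rwhisk γ (g' ∘m f')} (lwhisk-* h (lwhisk g α) (rwhisk β f')) ≃-refl ⟩
  (lwhisk h (lwhisk g α) * lwhisk h (rwhisk β f')) * rwhisk γ (g' ∘m f')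
    ≈⟨ *-assoc (lwhisk h (lwhisk g α)) (lwhisk h (rwhisk β f')) (rwhisk γ (g' ∘m f')) ⟩
  lwhisk h (lwhisk g α) * (lwhisk h (rwhisk β f') * rwhisk γ (g' ∘m f'))
    ≈⟨ pointwise-≃ _ _ refl (λ _ _ _ → refl) ⟩
  lwhisk (h ∘m g) α * (rwhisk (lwhisk h β) f' * rwhisk (rwhisk γ g') f')
    ≈⟨ *-cong {α = lwhisk (h ∘m g) α} ≃-refl (rwhisk-* (lwhisk h β) (rwhisk γ g') f') ⟨
  lwhisk (h ∘m g) α * rwhisk (lwhisk h β * rwhisk γ g') f' ∎
  where open ≃-Reasoning

⊚-identityˡ : {f f' : Mor G H} (α : Htpy f f') → idH (idMor G) ⊚ α ≃ α
⊚-identityˡ α = pointwise-≃ _ α refl (λ _ _ _ → refl)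

-- Whiskering by an identity does nothing, so this is the right unit law for *.
⊚-identityʳ : {f f' : Mor G H} (α : Htpy f f') → α ⊚ idH (idMor H) ≃ α
⊚-identityʳ {f' = f'} α =
  pointwise-≃ _ (α * idH f') refl (λ _ _ _ → refl) ◅◅ *-identityʳ α

⊚-idH : (f : Mor G H) (g : Mor H K) → idH f ⊚ idH g ≃ idH (g ∘m f)
⊚-idH f g = pointwise-≃ _ _ refl (λ _ _ _ → refl)

-- Monotone lattice paths in ℕ × ℕ, starting at the origin

data Dir : Set where
  east north : Dir

Point : Set
Point = ℕ × ℕ

move : Dir → Point → Point
move east  (i , j) = suc i , j
move north (i , j) = i , suc j

Path : Set
Path = List Dir

-- Position after k steps.  Moves are translations, so the first step may be
-- applied last; past the end of the path the position stays put.
pos : Path → ℕ → Point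
pos p       zero    = 0 , 0
pos []      (suc k) = 0 , 0
pos (d ∷ p) (suc k) = move d (pos p k)

endpoint : Path → Point
endpoint p = pos p (length p)

Near² : Point → Point → Set
Near² (i , j) (i' , j') = Near i i' × Near j j'

Near²-refl : ∀ {c} → Near² c c
Near²-refl = Near-refl , Near-refl

Near²-sym : ∀ {c c'} → Near² c c' → Near² c' c
Near²-sym (ni , nj) = Near-sym ni , Near-sym nj

Near²-move : ∀ d {c c'} → Near² c c' → Near² (move d c) (move d c')
Near²-move east  (ni , nj) = Near-suc ni , nj
Near²-move north (ni , nj) = ni , Near-suc nj

pos-step : ∀ p k → Near² (pos p k) (pos p (suc k))
pos-step []          zero    = Near²-refl
pos-step []          (suc k) = Near²-refl
pos-step (east ∷ p)  zero    = inj₂ (inj₁ refl) , Near-refl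
pos-step (north ∷ p) zero    = Near-refl , inj₂ (inj₁ refl)
pos-step (d ∷ p)     (suc k) = Near²-move d (pos-step p k)

east-run : ∀ n p {k} → k ≤ n → pos (replicate n east ++ p) k ≡ (k , 0)
east-run n       p {zero}  _         = refl
east-run (suc n) p {suc k} (s≤s k≤n) = cong (move east) (east-run n p k≤n)

north-run : ∀ n p {k} → k ≤ n → pos (replicate n north ++ p) k ≡ (0 , k)
north-run n       p {zero}  _         = refl
north-run (suc n) p {suc k} (s≤s k≤n) = cong (move north) (north-run n p k≤n)

east-after : ∀ n p q →
  pos (replicate n east ++ p) (n + q) ≡ (n + proj₁ (pos p q) , proj₂ (pos p q))
east-after zero    p q = refl
east-after (suc n) p q = cong (move east) (east-after n p q)

north-after : ∀ n p q →
  pos (replicate n north ++ p) (n + q) ≡ (proj₁ (pos p q) , n + proj₂ (pos p q))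
north-after zero    p q = refl
north-after (suc n) p q = cong (move north) (north-after n p q)

length-runs : ∀ (d d' : Dir) a b → length (replicate a d ++ replicate b d' ++ []) ≡ a + b
length-runs d d' zero    zero    = refl
length-runs d d' zero    (suc b) = cong suc (length-runs d d' zero b)
length-runs d d' (suc a) b       = cong suc (length-runs d d' a b)

data Swap : Path → Path → Set where
  here  : ∀ p → Swap (east ∷ north ∷ p) (north ∷ east ∷ p)
  there : ∀ d {p p'} → Swap p p' → Swap (d ∷ p) (d ∷ p')

swap-length : ∀ {p p'} → Swap p p' → length p ≡ length p'
swap-length (here p)     = refl
swap-length (there d sw) = cong suc (swap-length sw)

swap-endpoint : ∀ {p p'} → Swap p p' → endpoint p ≡ endpoint p'
swap-endpoint (here p)     = refl
swap-endpoint (there d sw) = cong (move d) (swap-endpoint sw)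

-- Positions on the two paths at near times are king-adjacent: they differ
-- only inside the flipped unit square.
swap-near : ∀ {p p'} → Swap p p' → ∀ {k k'} → Near k k' → Near² (pos p k) (pos p' k')
swap-near (here p) {zero}        (inj₁ refl)        = Near²-refl
swap-near (here p) {suc zero}    (inj₁ refl)        = inj₂ (inj₂ refl) , inj₂ (inj₁ refl)
swap-near (here p) {suc (suc k)} (inj₁ refl)        = Near²-refl
swap-near (here p) {zero}        (inj₂ (inj₁ refl)) = pos-step (north ∷ east ∷ p) 0
swap-near (here p) {suc zero}    (inj₂ (inj₁ refl)) = Near-refl , inj₂ (inj₁ refl)
swap-near (here p) {suc (suc k)} (inj₂ (inj₁ refl)) =
  Near²-move east (Near²-move north (pos-step p k))
swap-near (here p) {_} {zero}        (inj₂ (inj₂ refl)) = Near²-sym (pos-step (east ∷ north ∷ p) 0)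
swap-near (here p) {_} {suc zero}    (inj₂ (inj₂ refl)) = inj₂ (inj₂ refl) , Near-refl
swap-near (here p) {_} {suc (suc k)} (inj₂ (inj₂ refl)) =
  Near²-sym (Near²-move east (Near²-move north (pos-step p k)))
swap-near (there d sw)     {zero}  (inj₁ refl)        = Near²-refl
swap-near (there d sw)     {suc k} (inj₁ refl)        = Near²-move d (swap-near sw {k} (inj₁ refl))
swap-near (there d {p' = p'} sw) {zero} (inj₂ (inj₁ refl)) = pos-step (d ∷ p') 0
swap-near (there d sw)     {suc k} (inj₂ (inj₁ refl)) =
  Near²-move d (swap-near sw {k} (inj₂ (inj₁ refl)))
swap-near (there d {p} sw) {_} {zero}  (inj₂ (inj₂ refl)) = Near²-sym (pos-step (d ∷ p) 0)
swap-near (there d sw)     {_} {suc k} (inj₂ (inj₂ refl)) =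
  Near²-move d (swap-near sw {_} {k} (inj₂ (inj₂ refl)))

there⋆ : ∀ d {p p'} → Star Swap p p' → Star Swap (d ∷ p) (d ∷ p')
there⋆ d = gmap (d ∷_) (λ {q} {q'} → there d {q} {q'})

east-past-north : ∀ b p →
  Star Swap (east ∷ replicate b north ++ p) (replicate b north ++ east ∷ p)
east-past-north zero    p = ε
east-past-north (suc b) p = here _ ◅ there⋆ north (east-past-north b p)

bubble : ∀ a b p →
  Star Swap (replicate a east ++ replicate b north ++ p) (replicate b north ++ replicate a east ++ p)
bubble zero    b p = ε
bubble (suc a) b p =
  there⋆ east (bubble a b p) ◅◅ east-past-north b (replicate a east ++ p)

-- Exchange: gα * βf' ≃ βf * g'α

module Exchange {G H K : Graph} {f f' : Mor G H} {g g' : Mor H K}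
                (α : Htpy f f') (β : Htpy g g') where

  la lb : ℕ
  la = len α
  lb = len β

  grid : Point → Mor G K
  grid (i , j) = walk β j ∘m walk α i

  grid-adj : ∀ c c' → Near² c c' → ExpAdj (grid c) (grid c')
  grid-adj (i , j) (i' , j') (ni , nj) =
    ExpAdj-∘ {f = walk α i} {walk α i'} {walk β j} {walk β j'}
      (walk-adj α ni) (walk-adj β nj)

  grid-inside : ∀ {i j} → i ≤ la → j ≤ lb → grid (i , j) ≡ at β j ∘m at α i
  grid-inside i≤la j≤lb = cong₂ _∘m_ (walk-≤ β j≤lb) (walk-≤ α i≤la)

  along : (p : Path) → endpoint p ≡ (la , lb) → Htpy (g ∘m f) (g' ∘m f')
  along p ends = record
    { len   = length p
    ; at    = λ k → grid (pos p k)
    ; start = λ v → trans (cong (map (at β 0)) (start α v)) (start β (map f v))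
    ; end   = λ v → trans (≡⇒≈m (trans (cong grid ends) (grid-inside ≤-refl ≤-refl)) v)
                          (trans (cong (map (at β lb)) (end α v)) (end β (map f' v)))
    ; step  = λ k _ → grid-adj (pos p k) (pos p (suc k)) (pos-step p k) }

  along-swaps : ∀ {p p'} → Star Swap p p' →
    (ends : endpoint p ≡ (la , lb)) (ends' : endpoint p' ≡ (la , lb)) →
    along p ends ≃ along p' ends'
  along-swaps ε            ends ends' = pointwise-≃ _ _ refl (λ _ _ _ → refl)
  along-swaps {p} (_◅_ {j = q} sw swaps) ends ends' =
    (swap-length sw , λ k k' _ _ n → grid-adj (pos p k) (pos q k') (swap-near sw n))
    ◅ along-swaps swaps (trans (sym (swap-endpoint sw)) ends) ends'

  east-north north-east : Path
  east-north = replicate la east ++ replicate lb north ++ []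
  north-east = replicate lb north ++ replicate la east ++ []

  east-north-pos : ∀ j → j ≤ lb → pos east-north (la + j) ≡ (la , j)
  east-north-pos j j≤lb = begin
    pos east-north (la + j)
      ≡⟨ east-after la _ j ⟩
    (la + proj₁ (pos north-leg j) , proj₂ (pos north-leg j))
      ≡⟨ cong (λ c → la + proj₁ c , proj₂ c) (north-run lb [] j≤lb) ⟩
    (la + 0 , j)
      ≡⟨ cong (_, j) (+-identityʳ la) ⟩
    (la , j) ∎
    where
    open ≡-Reasoning
    north-leg = replicate lb north ++ []

  north-east-pos : ∀ i → i ≤ la → pos north-east (lb + i) ≡ (i , lb)
  north-east-pos i i≤la = begin
    pos north-east (lb + i)
      ≡⟨ north-after lb _ i ⟩
    (proj₁ (pos east-leg i) , lb + proj₂ (pos east-leg i))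
      ≡⟨ cong (λ c → proj₁ c , lb + proj₂ c) (east-run la [] i≤la) ⟩
    (i , lb + 0)
      ≡⟨ cong (i ,_) (+-identityʳ lb) ⟩
    (i , lb) ∎
    where
    open ≡-Reasoning
    east-leg = replicate la east ++ []

  east-north-ends : endpoint east-north ≡ (la , lb)
  east-north-ends =
    trans (cong (pos east-north) (length-runs east north la lb)) (east-north-pos lb ≤-refl)

  north-east-ends : endpoint north-east ≡ (la , lb)
  north-east-ends =
    trans (cong (pos north-east) (length-runs north east lb la)) (north-east-pos la ≤-refl)

  -- gα * βf' is the grid along east-then-north: first row 0, then column la.
  ⊚-along : α ⊚ β ≃ along east-north east-north-ends
  ⊚-along = pointwise-≃ _ _ (sym (length-runs east north la lb))
    (cat-split la lb _ _ (λ k → grid (pos east-north k)) row column)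
    where
    row : ∀ i → i < la → (g ∘m at α i) ≈m grid (pos east-north i)
    row i i<la v = trans (sym (start β (map (at α i) v)))
      (≡⇒≈m (sym (trans (cong grid (east-run la _ (<⇒≤ i<la))) (grid-inside (<⇒≤ i<la) z≤n))) v)
    column : ∀ j → j ≤ lb → (at β j ∘m f') ≈m grid (pos east-north (la + j))
    column j j≤lb v = trans (cong (map (at β j)) (sym (end α v)))
      (≡⇒≈m (sym (trans (cong grid (east-north-pos j j≤lb)) (grid-inside ≤-refl j≤lb))) v)

  -- βf * g'α is the grid along north-then-east: first column 0, then row lb.
  swapped-along : rwhisk β f * lwhisk g' α ≃ along north-east north-east-ends
  swapped-along = pointwise-≃ _ _ (sym (length-runs north east lb la))
    (cat-split lb la _ _ (λ k → grid (pos north-east k)) column row)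
    where
    column : ∀ j → j < lb → (at β j ∘m f) ≈m grid (pos north-east j)
    column j j<lb v = trans (cong (map (at β j)) (sym (start α v)))
      (≡⇒≈m (sym (trans (cong grid (north-run lb _ (<⇒≤ j<lb))) (grid-inside z≤n (<⇒≤ j<lb)))) v)
    row : ∀ i → i ≤ la → (g' ∘m at α i) ≈m grid (pos north-east (lb + i))
    row i i≤la v = trans (sym (end β (map (at α i) v)))
      (≡⇒≈m (sym (trans (cong grid (north-east-pos i i≤la)) (grid-inside i≤la ≤-refl))) v)

  exchange : α ⊚ β ≃ rwhisk β f * lwhisk g' α
  exchange = ⊚-along
    ◅◅ along-swaps (bubble la lb []) east-north-ends north-east-ends
    ◅◅ ≃-sym swapped-along

open Exchange using (exchange)

interchange : {f f' f'' : Mor G H} {g g' g'' : Mor H K}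
  (α : Htpy f f') (α' : Htpy f' f'') (β : Htpy g g') (β' : Htpy g' g'') →
  (α * α') ⊚ (β * β') ≃ (α ⊚ β) * (α' ⊚ β')
interchange {f' = f'} {f''} {g} {g'} α α' β β' = begin
  lwhisk g (α * α') * rwhisk (β * β') f''
    ≈⟨ *-cong (lwhisk-* g α α') (rwhisk-* β β' f'') ⟩
  (gα * gα') * (βf'' * β'f'')
    ≈⟨ *-assoc gα gα' (βf'' * β'f'') ⟩
  gα * (gα' * (βf'' * β'f''))
    ≈⟨ *-cong {α = gα} ≃-refl (*-assoc gα' βf'' β'f'') ⟨
  gα * ((gα' * βf'') * β'f'')
    ≈⟨ *-cong {α = gα} ≃-refl (*-cong {β = β'f''} (exchange α' β) ≃-refl) ⟩
  gα * ((βf' * g'α') * β'f'')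
    ≈⟨ *-cong {α = gα} ≃-refl (*-assoc βf' g'α' β'f'') ⟩
  gα * (βf' * (g'α' * β'f''))
    ≈⟨ *-assoc gα βf' (g'α' * β'f'') ⟨
  (gα * βf') * (g'α' * β'f'') ∎
  where
  open ≃-Reasoning
  gα = lwhisk g α
  gα' = lwhisk g α'
  g'α' = lwhisk g' α'
  βf' = rwhisk β f'
  βf'' = rwhisk β f''
  β'f'' = rwhisk β' f''

theorem3p18 : IsTwoCategory
theorem3p18 = record
  { ≃-isEquivalence = ≃-isEquivalence
  ; *-cong          = *-cong
  ; ⊚-cong          = ⊚-cong
  ; *-assoc         = *-assoc
  ; *-identityˡ     = *-identityˡ
  ; *-identityʳ     = *-identityʳ
  ; ⊚-assoc         = ⊚-assoc
  ; ⊚-identityˡ     = ⊚-identityˡ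
  ; ⊚-identityʳ     = ⊚-identityʳ
  ; ⊚-idH           = ⊚-idH
  ; interchange     = interchange
  }
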